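{- Let $w\ge1$, let $\boldsymbol{\lambda},\boldsymbol{\mu}$ be partitions of $w$, and let $\Gamma$ be a directed cycle of length $w$. Assume that $\Gamma$ has a $\boldsymbol{\lambda}$-tiling $S$ which is unique up to isomorphism and that $\mathrm{Aut}(\Gamma,S)$ is trivial. Similarly assume that $\Gamma$ has a $\boldsymbol{\mu}$-tiling $T$ which is unique up to isomorphism and that $\mathrm{Aut}(\Gamma,T)$ is trivial. Then $\eta_{\boldsymbol{\lambda}\boldsymbol{\mu}}(\Gamma)=w$.
   Context: A partition of $w$ is a multiset of positive integers with sum $w$. A directed cycle of length $\ge1$ is considered; a cycle digraph is a disjoint union of finitely many directed cycles. For a cycle digraph $\Gamma$ with $w$ vertices and a partition $\boldsymbol{\lambda}$ of $w$, a $\boldsymbol{\lambda}$-tiling of $\Gamma$ is a set $S$ of subgraphs of $\Gamma$, each a directed path of length $\ge0$, whose vertex sets partition $V(\Gamma)$, and such that the multiset $\{|V(\gamma)|:\gamma\in S\}$ equals $\boldsymbol{\lambda}$. Two $\boldsymbol{\lambda}$-tilings $S,S'$ of $\Gamma$ are isomorphic if some digraph automorphism of $\Gamma$ carries $S$ onto $S'$; $\mathrm{Aut}(\Gamma,S)$ is the group of digraph automorphisms of $\Gamma$ carrying $S$ onto $S$. A $(\boldsymbol{\lambda},\boldsymbol{\mu})$-tiling is an ordered pair $(S,T)$ with $S$ a $\boldsymbol{\lambda}$-tiling and $T$ a $\boldsymbol{\mu}$-tiling of $\Gamma$; an isomorphism $(\Gamma,S,T)\to(\Gamma',S',T')$ is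 a digraph isomorphism carrying $S$ onto $S'$ and $T$ onto $T'$. $(S,T)$ is admissible if $(\Gamma,S,T)$ has no nontrivial automorphisms; $(S,T)$ and $(S',T')$ are isomorphic if there is an isomorphism $(\Gamma,S,T)\to(\Gamma,S',T')$. $\eta_{\boldsymbol{\lambda}\boldsymbol{\mu}}(\Gamma)$ denotes the number of isomorphism classes of admissible $(\boldsymbol{\lambda},\boldsymbol{\mu})$-tilings of $\Gamma$. -}

module Defs where

open import Data.Nat using (ℕ; zero; suc; _≤_; _<_; _%_; _+_; _∸_)
open import Data.Nat.ListAction using (sum)
open import Data.Fin using (Fin; toℕ)
open import Data.Fin.Permutation using (Permutation′; _⟨$⟩ʳ_)
open import Data.Bool using (Bool; true)
import Data.Bool.Properties as BoolP
open import Data.List using (List; map; filter; allFin; cartesianProduct)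
open import Data.List.Relation.Unary.All using (All)
open import Data.List.Relation.Binary.Permutation.Propositional using (_↭_)
open import Data.Product using (Σ; _×_; _,_; proj₁; proj₂; ∃)
open import Data.Vec using (Vec; lookup)
open import Relation.Binary.PropositionalEquality using (_≡_)
open import Relation.Nullary using (¬_)
open import Function.Bundles using (_⇔_)

-- A partition of w: a multiset (list up to permutation) of positive integers with sum w.
IsPartition : ℕ → List ℕ → Set
IsPartition w λs = All (λ k → 0 < k) λs × sum λs ≡ w

module Cycle (n : ℕ) where

  w : ℕ
  w = suc n

  Vertex : Set
  Vertex = Fin w

  Edge : Vertex → Vertex → Set
  Edge i j = toℕ j ≡ suc (toℕ i) % w

  -- A directed path (of length ≥ 0) in Γ, given by its start vertex s and
  -- its length l (so it has l+1 ≤ w vertices s, s+1, …, s+l mod w).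
  -- Distinct pairs (s , l) give distinct subgraphs of Γ.
  Path : Set
  Path = Vertex × Fin w

  size : Path → ℕ
  size p = suc (toℕ (proj₂ p))

  _∈P_ : Vertex → Path → Set
  v ∈P (s , l) = ((toℕ v + (w ∸ toℕ s)) % w) ≤ toℕ l

  allPaths : List Path
  allPaths = cartesianProduct (allFin w) (allFin w)

  PathSet : Set
  PathSet = Path → Bool

  sizes : PathSet → List ℕ
  sizes S = map size (filter (λ p → S p BoolP.≟ true) allPaths)

  IsTiling : List ℕ → PathSet → Set
  IsTiling λs S =
    (∀ v → Σ Path λ p → (S p ≡ true) × (v ∈P p) ×
             (∀ q → S q ≡ true → v ∈P q → q ≡ p))
    × (sizes S ↭ λs)

  record Aut : Set where
    field
      perm : Permutation′ w
      preserves : ∀ i j → Edge i j ⇔ Edge (perm ⟨$⟩ʳ i) (perm ⟨$⟩ʳ j)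
  open Aut public

  -- Image of a path under an automorphism: the path s → … → s+l is sent to
  -- f s → … → f (s+l), which is the path starting at f s of the same length.
  act : Aut → Path → Path
  act f (s , l) = (perm f ⟨$⟩ʳ s , l)

  Carries : Aut → PathSet → PathSet → Set
  Carries f S S' = ∀ p → S' (act f p) ≡ S p

  IsIdentity : Aut → Set
  IsIdentity f = ∀ v → perm f ⟨$⟩ʳ v ≡ v

  IsoTiling : PathSet → PathSet → Set
  IsoTiling S S' = Σ Aut λ f → Carries f S S'

  AutTrivial : PathSet → Set
  AutTrivial S = ∀ f → Carries f S S → IsIdentity f

  UniqueRigidTiling : List ℕ → Set
  UniqueRigidTiling λs =
    Σ PathSet λ S → IsTiling λs S × AutTrivial S ×
      (∀ S' → IsTiling λs S' → IsoTiling S S')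

  Pair : Set
  Pair = PathSet × PathSet

  IsPairTiling : List ℕ → List ℕ → Pair → Set
  IsPairTiling λs μs (S , T) = IsTiling λs S × IsTiling μs T

  IsoPair : Pair → Pair → Set
  IsoPair (S , T) (S' , T') = Σ Aut λ f → Carries f S S' × Carries f T T'

  Admissible : Pair → Set
  Admissible (S , T) = ∀ f → Carries f S S → Carries f T T → IsIdentity f

  -- The number of isomorphism classes of admissible (λ, μ)-tilings of Γ is k:
  -- there is a system of k pairwise non-isomorphic admissible (λ, μ)-tilings
  -- such that every admissible (λ, μ)-tiling is isomorphic to one of them.
  η≡ : List ℕ → List ℕ → ℕ → Set
  η≡ λs μs k =
    Σ (Vec Pair k) λ reps →
      (∀ i → IsPairTiling λs μs (lookup reps i) × Admissible (lookup reps i))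
      × (∀ i j → IsoPair (lookup reps i) (lookup reps j) → i ≡ j)
      × (∀ P → IsPairTiling λs μs P → Admissible P → ∃ λ i → IsoPair P (lookup reps i))

-- Vertices of Γ are residues mod w and the automorphisms of Γ are
-- exactly the rotations v ↦ v + k.  The w pairs (S , T rotated by i), for
-- i = 0, …, w-1, are a system of representatives:
--   * each is admissible, since already S has no nontrivial automorphism;
--   * two of them are isomorphic only via an automorphism fixing S, i.e. the
--     identity, so T is invariant under the rotation by j - i, which forces
--     i = j because T is rigid;
--   * any admissible (S', T') is carried to (S , T rotated by i) by f⁻¹,
--     where f : S ≅ S', g : T ≅ T', and g⁻¹ ∘ f is the rotation by i.

module Submission where

open import Defs
open import Data.Nat using (ℕ; zero; suc; _+_; _∸_; _%_; _≤_; _<_; NonZero)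
open import Data.Nat.Properties using (+-comm; +-assoc; m+[n∸m]≡n; m∸n+n≡m; <⇒≤)
open import Data.Nat.DivMod
  using (_mod_; m%n<n; m%n≤n; m<n⇒m%n≡m; %-distribˡ-+; m%n%n≡m%n; n%n≡0; [m+n]%n≡m%n; %-remove-+ʳ)
open import Data.Nat.Divisibility using (_∣_; _∣0; m%n≡0⇒n∣m)
open import Data.Bool using (true)
import Data.Bool.Properties as BoolP
open import Data.Fin using (Fin; toℕ)
open import Data.Fin.Properties using (toℕ<n; toℕ-injective; toℕ-fromℕ<)
open import Data.Fin.Permutation using (_⟨$⟩ʳ_; _⟨$⟩ˡ_; permutation; flip; _∘ₚ_; inverseʳ; inverseˡ)
open import Data.List using (List; map; filter)
open import Data.List.Properties using (map-∘)
open import Data.List.Membership.Propositional using (_∈_)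
open import Data.List.Membership.Propositional.Properties
  using (∈-map⁺; ∈-map⁻; ∈-filter⁺; ∈-filter⁻; ∈-cartesianProduct⁺; ∈-allFin)
open import Data.List.Membership.Propositional.Properties.WithK using (unique∧set⇒bag)
open import Data.List.Relation.Binary.BagAndSetEquality using (∼bag⇒↭)
open import Data.List.Relation.Unary.Unique.Propositional using (Unique)
import Data.List.Relation.Unary.Unique.Propositional.Properties as Unique
open import Data.List.Relation.Binary.Permutation.Propositional using (_↭_; ↭-trans; ↭-reflexive)
import Data.List.Relation.Binary.Permutation.Propositional.Properties as Perm
open import Data.Product using (Σ; _×_; _,_; proj₁; proj₂; ∃)
open import Data.Vec using (tabulate; lookup)
open import Data.Vec.Properties using (lookup∘tabulate)
open import Function using (_∘_)
open import Relation.Nullary using (Dec)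
open import Function.Bundles using (_⇔_; _↔_; mk⇔; Equivalence)
open import Relation.Binary.PropositionalEquality
  using (_≡_; refl; sym; trans; cong; cong₂; subst; subst₂; module ≡-Reasoning)

module ModularArithmetic (m : ℕ) .{{_ : NonZero m}} where

  %-absorbˡ : ∀ a b → (a % m + b) % m ≡ (a + b) % m
  %-absorbˡ a b = begin
    (a % m + b) % m          ≡⟨ %-distribˡ-+ (a % m) b m ⟩
    (a % m % m + b % m) % m  ≡⟨ cong (λ x → (x + b % m) % m) (m%n%n≡m%n a m) ⟩
    (a % m + b % m) % m      ≡⟨ %-distribˡ-+ a b m ⟨
    (a + b) % m              ∎
    where open ≡-Reasoning

  complement : ℕ → ℕ
  complement k = m ∸ k % m

  m∣k+complement : ∀ k → m ∣ k + complement k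
  m∣k+complement k = m%n≡0⇒n∣m (k + complement k) m (begin
    (k + complement k) % m      ≡⟨ %-absorbˡ k (complement k) ⟨
    (k % m + complement k) % m  ≡⟨ cong (_% m) (m+[n∸m]≡n (m%n≤n k m)) ⟩
    m % m                       ≡⟨ n%n≡0 m ⟩
    0                           ∎)
    where open ≡-Reasoning

  +-cancelˡ-% : ∀ t a b → (t + a) % m ≡ (t + b) % m → a % m ≡ b % m
  +-cancelˡ-% t a b eq = trans (sym (undo a)) (trans (cong (λ x → (x + complement t) % m) eq) (undo b))
    where
      open ≡-Reasoning
      undo : ∀ x → ((t + x) % m + complement t) % m ≡ x % m
      undo x = begin
        ((t + x) % m + complement t) % m  ≡⟨ %-absorbˡ (t + x) (complement t) ⟩
        (t + x + complement t) % m        ≡⟨ cong (λ y → (y + complement t) % m) (+-comm t x) ⟩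
        (x + t + complement t) % m        ≡⟨ cong (_% m) (+-assoc x t (complement t)) ⟩
        (x + (t + complement t)) % m      ≡⟨ %-remove-+ʳ x (m∣k+complement t) ⟩
        x % m                             ∎

module Rotations (n : ℕ) where
  open Cycle n
  open ModularArithmetic w public

  residue : ∀ (v : Vertex) → toℕ v % w ≡ toℕ v
  residue v = m<n⇒m%n≡m (toℕ<n v)

  rotate : ℕ → Vertex → Vertex
  rotate k v = (toℕ v + k) mod w

  toℕ-rotate : ∀ k v → toℕ (rotate k v) ≡ (toℕ v + k) % w
  toℕ-rotate k v = toℕ-fromℕ< (m%n<n (toℕ v + k) w)

  rotate-∘ : ∀ a b v → rotate a (rotate b v) ≡ rotate (b + a) v
  rotate-∘ a b v = toℕ-injective (begin
    toℕ (rotate a (rotate b v))   ≡⟨ toℕ-rotate a (rotate b v) ⟩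
    (toℕ (rotate b v) + a) % w    ≡⟨ cong (λ x → (x + a) % w) (toℕ-rotate b v) ⟩
    ((toℕ v + b) % w + a) % w     ≡⟨ %-absorbˡ (toℕ v + b) a ⟩
    (toℕ v + b + a) % w           ≡⟨ cong (_% w) (+-assoc (toℕ v) b a) ⟩
    (toℕ v + (b + a)) % w         ≡⟨ toℕ-rotate (b + a) v ⟨
    toℕ (rotate (b + a) v)        ∎)
    where open ≡-Reasoning

  rotate-comm : ∀ a b v → rotate a (rotate b v) ≡ rotate b (rotate a v)
  rotate-comm a b v = trans (rotate-∘ a b v) (trans (cong (λ k → rotate k v) (+-comm b a)) (sym (rotate-∘ b a v)))

  rotate-multiple : ∀ {k} v → w ∣ k → rotate k v ≡ v
  rotate-multiple {k} v w∣k = toℕ-injective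
    (trans (toℕ-rotate k v) (trans (%-remove-+ʳ (toℕ v) w∣k) (residue v)))

  rotate-inverseˡ : ∀ k v → rotate k (rotate (complement k) v) ≡ v
  rotate-inverseˡ k v = trans (rotate-∘ k (complement k) v)
    (rotate-multiple v (subst (w ∣_) (+-comm k (complement k)) (m∣k+complement k)))

  rotate-inverseʳ : ∀ k v → rotate (complement k) (rotate k v) ≡ v
  rotate-inverseʳ k v = trans (rotate-∘ (complement k) k v) (rotate-multiple v (m∣k+complement k))

  rotate-injective : ∀ k {u v} → rotate k u ≡ rotate k v → u ≡ v
  rotate-injective k {u} {v} eq =
    trans (sym (rotate-inverseʳ k u)) (trans (cong (rotate (complement k)) eq) (rotate-inverseʳ k v))

  rotate-zero : ∀ u → rotate (toℕ u) Fin.zero ≡ u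
  rotate-zero u = toℕ-injective (trans (toℕ-rotate (toℕ u) Fin.zero) (residue u))

  next : Vertex → Vertex
  next = rotate 1

  rotate-suc : ∀ k v → rotate (suc k) v ≡ next (rotate k v)
  rotate-suc k v = sym (trans (rotate-∘ 1 k v) (cong (λ j → rotate j v) (+-comm k 1)))

  edge⇔next : ∀ i j → Edge i j ⇔ (j ≡ next i)
  edge⇔next i j = mk⇔ (λ e → toℕ-injective (trans e (sym toℕ-next))) (λ e → trans (cong toℕ e) toℕ-next)
    where
      toℕ-next : toℕ (next i) ≡ suc (toℕ i) % w
      toℕ-next = trans (toℕ-rotate 1 i) (cong (_% w) (+-comm (toℕ i) 1))

  -- Rotations commute with next, hence preserve and reflect edges.
  rotate-preserves-edges : ∀ k i j → Edge i j ⇔ Edge (rotate k i) (rotate k j)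
  rotate-preserves-edges k i j = mk⇔
    (λ e → Equivalence.from (edge⇔next _ _)
      (trans (cong (rotate k) (Equivalence.to (edge⇔next i j) e)) (rotate-comm k 1 i)))
    (λ e → Equivalence.from (edge⇔next i j)
      (rotate-injective k (trans (Equivalence.to (edge⇔next _ _) e) (rotate-comm 1 k i))))

  rot : ℕ → Aut
  rot k = record
    { perm = permutation (rotate k) (rotate (complement k)) (rotate-inverseˡ k) (rotate-inverseʳ k)
    ; preserves = rotate-preserves-edges k }

  -- Edge homomorphisms of Γ are rotations: they commute with next, so they
  -- are determined by the image of vertex 0.
  EdgeHom : (Vertex → Vertex) → Set
  EdgeHom φ = ∀ i j → Edge i j → Edge (φ i) (φ j)

  edgeHom-is-rotation : ∀ φ → EdgeHom φ → ∀ v → φ v ≡ rotate (toℕ (φ Fin.zero)) v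
  edgeHom-is-rotation φ hom v = begin
    φ v                                                  ≡⟨ cong φ (rotate-zero v) ⟨
    φ (rotate (toℕ v) Fin.zero)                          ≡⟨ orbit (toℕ v) ⟩
    rotate (toℕ v) (φ Fin.zero)                          ≡⟨ cong (rotate (toℕ v)) (rotate-zero (φ Fin.zero)) ⟨
    rotate (toℕ v) (rotate (toℕ (φ Fin.zero)) Fin.zero)  ≡⟨ rotate-comm (toℕ v) _ Fin.zero ⟩
    rotate (toℕ (φ Fin.zero)) (rotate (toℕ v) Fin.zero)  ≡⟨ cong (rotate _) (rotate-zero v) ⟩
    rotate (toℕ (φ Fin.zero)) v                          ∎
    where
      open ≡-Reasoning
      commutes : ∀ u → φ (next u) ≡ next (φ u)
      commutes u = Equivalence.to (edge⇔next _ _) (hom u (next u) (Equivalence.from (edge⇔next _ _) refl))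
      orbit : ∀ k → φ (rotate k Fin.zero) ≡ rotate k (φ Fin.zero)
      orbit zero = trans (cong φ (rotate-multiple Fin.zero (w ∣0))) (sym (rotate-multiple _ (w ∣0)))
      orbit (suc k) = begin
        φ (rotate (suc k) Fin.zero)    ≡⟨ cong φ (rotate-suc k Fin.zero) ⟩
        φ (next (rotate k Fin.zero))   ≡⟨ commutes (rotate k Fin.zero) ⟩
        next (φ (rotate k Fin.zero))   ≡⟨ cong next (orbit k) ⟩
        next (rotate k (φ Fin.zero))   ≡⟨ rotate-suc k (φ Fin.zero) ⟨
        rotate (suc k) (φ Fin.zero)    ∎

  aut-is-rotation : ∀ f v → perm f ⟨$⟩ʳ v ≡ rotate (toℕ (perm f ⟨$⟩ʳ Fin.zero)) v
  aut-is-rotation f = edgeHom-is-rotation (perm f ⟨$⟩ʳ_) (λ i j → Equivalence.to (preserves f i j))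

  invA : Aut → Aut
  invA f = record { perm = flip (perm f) ; preserves = reflects }
    where
      reflects : ∀ i j → Edge i j ⇔ Edge (perm f ⟨$⟩ˡ i) (perm f ⟨$⟩ˡ j)
      reflects i j = mk⇔
        (λ e → Equivalence.from (preserves f _ _) (subst₂ Edge (sym (inverseʳ (perm f))) (sym (inverseʳ (perm f))) e))
        (λ e → subst₂ Edge (inverseʳ (perm f)) (inverseʳ (perm f)) (Equivalence.to (preserves f _ _) e))

  _⨾_ : Aut → Aut → Aut
  f ⨾ g = record
    { perm = perm f ∘ₚ perm g
    ; preserves = λ i j → mk⇔
        (Equivalence.to (preserves g _ _) ∘ Equivalence.to (preserves f i j))
        (Equivalence.from (preserves f i j) ∘ Equivalence.from (preserves g _ _)) }

  act-inverseˡ : ∀ f p → act (invA f) (act f p) ≡ p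
  act-inverseˡ f (s , l) = cong (_, l) (inverseˡ (perm f))

  act-inverseʳ : ∀ f p → act f (act (invA f) p) ≡ p
  act-inverseʳ f (s , l) = cong (_, l) (inverseʳ (perm f))

  carries-inverse : ∀ f {X Y} → Carries f X Y → Carries (invA f) Y X
  carries-inverse f {X} {Y} c p = trans (sym (c (act (invA f) p))) (cong Y (act-inverseʳ f p))

  carries-⨾ : ∀ f g {X Y Z} → Carries f X Y → Carries g Y Z → Carries (f ⨾ g) X Z
  carries-⨾ f g c d p = trans (d (act f p)) (c p)

  -- The rotations of a rigid path set are pairwise distinct: if rotating T by i
  -- and by j agree, the automorphism "back by i, then forward by j" fixes T,
  -- so it is the identity and sends the vertex i to itself, i.e. to j.
  rigid-rotations-distinct : ∀ {T} → AutTrivial T → ∀ (i j : Vertex) →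
    (∀ p → T (act (rot (toℕ j)) p) ≡ T (act (rot (toℕ i)) p)) → i ≡ j
  rigid-rotations-distinct {T} rigid i j same = begin
    i                                     ≡⟨ rotate-zero i ⟨
    rotate (toℕ i) Fin.zero               ≡⟨ rigid h invariant (rotate (toℕ i) Fin.zero) ⟨
    rotate (toℕ j) (rotate (complement (toℕ i)) (rotate (toℕ i) Fin.zero))
                                          ≡⟨ cong (rotate (toℕ j)) (rotate-inverseʳ (toℕ i) Fin.zero) ⟩
    rotate (toℕ j) Fin.zero               ≡⟨ rotate-zero j ⟩
    j                                     ∎
    where
      open ≡-Reasoning
      h : Aut
      h = invA (rot (toℕ i)) ⨾ rot (toℕ j)
      invariant : Carries h T T
      invariant = carries-⨾ (invA (rot (toℕ i))) (rot (toℕ j)) {T} {T ∘ act (rot (toℕ i))} {T}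
        (carries-inverse (rot (toℕ i)) (λ _ → refl)) same

module TilingInvariance (n : ℕ) where
  open Cycle n
  open Rotations n

  -- offset v s is the number of steps from s to v; v lies on the path
  -- (s , l) iff this offset is at most l.
  offset : Vertex → Vertex → ℕ
  offset v s = (toℕ v + (w ∸ toℕ s)) % w

  rotate-offset : ∀ v s → rotate (offset v s) s ≡ v
  rotate-offset v s = toℕ-injective (begin
    toℕ (rotate (offset v s) s)        ≡⟨ toℕ-rotate (offset v s) s ⟩
    (toℕ s + offset v s) % w           ≡⟨ cong (_% w) (+-comm (toℕ s) (offset v s)) ⟩
    (offset v s + toℕ s) % w           ≡⟨ %-absorbˡ (toℕ v + (w ∸ toℕ s)) (toℕ s) ⟩
    (toℕ v + (w ∸ toℕ s) + toℕ s) % w  ≡⟨ cong (_% w) (+-assoc (toℕ v) (w ∸ toℕ s) (toℕ s)) ⟩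
    (toℕ v + (w ∸ toℕ s + toℕ s)) % w  ≡⟨ cong (λ x → (toℕ v + x) % w) (m∸n+n≡m (<⇒≤ (toℕ<n s))) ⟩
    (toℕ v + w) % w                    ≡⟨ [m+n]%n≡m%n (toℕ v) w ⟩
    toℕ v % w                          ≡⟨ residue v ⟩
    toℕ v                              ∎)
    where open ≡-Reasoning

  offset<w : ∀ v s → offset v s < w
  offset<w v s = m%n<n (toℕ v + (w ∸ toℕ s)) w

  offset-unique : ∀ {d d'} s → d < w → d' < w → rotate d s ≡ rotate d' s → d ≡ d'
  offset-unique {d} {d'} s d<w d'<w eq = trans (sym (m<n⇒m%n≡m d<w))
    (trans (+-cancelˡ-% (toℕ s) d d' (trans (sym (toℕ-rotate d s)) (trans (cong toℕ eq) (toℕ-rotate d' s))))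
           (m<n⇒m%n≡m d'<w))

  -- Rotations preserve offsets, since rotating both endpoints commutes with stepping.
  offset-rotate : ∀ k v s → offset (rotate k v) (rotate k s) ≡ offset v s
  offset-rotate k v s = offset-unique (rotate k s) (offset<w (rotate k v) (rotate k s)) (offset<w v s) (begin
    rotate (offset (rotate k v) (rotate k s)) (rotate k s)  ≡⟨ rotate-offset (rotate k v) (rotate k s) ⟩
    rotate k v                                              ≡⟨ cong (rotate k) (rotate-offset v s) ⟨
    rotate k (rotate (offset v s) s)                        ≡⟨ rotate-comm k (offset v s) s ⟩
    rotate (offset v s) (rotate k s)                        ∎)
    where open ≡-Reasoning

  ∈P-aut : ∀ f v p → v ∈P p ⇔ (perm f ⟨$⟩ʳ v) ∈P act f p
  ∈P-aut f v (s , l) = mk⇔ (subst (_≤ toℕ l) (sym same)) (subst (_≤ toℕ l) same)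
    where
      k : ℕ
      k = toℕ (perm f ⟨$⟩ʳ Fin.zero)
      same : offset (perm f ⟨$⟩ʳ v) (perm f ⟨$⟩ʳ s) ≡ offset v s
      same = trans (cong₂ offset (aut-is-rotation f v) (aut-is-rotation f s)) (offset-rotate k v s)

  Covers : PathSet → Set
  Covers X = ∀ v → Σ Path λ p → (X p ≡ true) × (v ∈P p) × (∀ q → X q ≡ true → v ∈P q → q ≡ p)

  -- The path through v in X ∘ act f is the preimage of the path through f v in X.
  covers-aut : ∀ f X → Covers X → Covers (X ∘ act f)
  covers-aut f X covers v with covers (perm f ⟨$⟩ʳ v)
  ... | p , Xp , fv∈p , unique = act (invA f) p , inX , v∈ , unique′
    where
      inX : X (act f (act (invA f) p)) ≡ true
      inX = subst (λ q → X q ≡ true) (sym (act-inverseʳ f p)) Xp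
      v∈ : v ∈P act (invA f) p
      v∈ = Equivalence.from (∈P-aut f v (act (invA f) p))
             (subst (λ q → (perm f ⟨$⟩ʳ v) ∈P q) (sym (act-inverseʳ f p)) fv∈p)
      unique′ : ∀ q → X (act f q) ≡ true → v ∈P q → q ≡ act (invA f) p
      unique′ q Xq v∈q = trans (sym (act-inverseˡ f q))
        (cong (act (invA f)) (unique (act f q) Xq (Equivalence.to (∈P-aut f v q) v∈q)))

  -- act f is a size-preserving bijection of the (duplicate-free) list of all
  -- paths, so it permutes the selected paths and their sizes.
  sizes-aut : ∀ f X → sizes (X ∘ act f) ↭ sizes X
  sizes-aut f X = ↭-trans (↭-reflexive (map-∘ selected)) (Perm.map⁺ size (∼bag⇒↭ bag))
    where
      selects : (Y : PathSet) → ∀ p → Dec (Y p ≡ true)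
      selects Y p = Y p BoolP.≟ true
      selected : List Path
      selected = filter (selects (X ∘ act f)) allPaths
      target : List Path
      target = filter (selects X) allPaths
      allPaths-complete : ∀ p → p ∈ allPaths
      allPaths-complete (s , l) = ∈-cartesianProduct⁺ (∈-allFin s) (∈-allFin l)
      allPaths-unique : Unique allPaths
      allPaths-unique = Unique.cartesianProduct⁺ (Unique.allFin⁺ w) (Unique.allFin⁺ w)
      act-injective : ∀ {p q} → act f p ≡ act f q → p ≡ q
      act-injective {p} {q} eq = trans (sym (act-inverseˡ f p)) (trans (cong (act (invA f)) eq) (act-inverseˡ f q))
      to : ∀ {p} → p ∈ map (act f) selected → p ∈ target
      to p∈ with ∈-map⁻ (act f) p∈
      ... | q , q∈ , refl = ∈-filter⁺ (selects X) (allPaths-complete _) (proj₂ (∈-filter⁻ (selects (X ∘ act f)) q∈))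
      from : ∀ {p} → p ∈ target → p ∈ map (act f) selected
      from {p} p∈ = subst (_∈ map (act f) selected) (act-inverseʳ f p)
        (∈-map⁺ (act f) (∈-filter⁺ (selects (X ∘ act f)) (allPaths-complete _)
          (subst (λ q → X q ≡ true) (sym (act-inverseʳ f p)) (proj₂ (∈-filter⁻ (selects X) p∈)))))
      bag : ∀ {p} → (p ∈ map (act f) selected) ↔ (p ∈ target)
      bag = unique∧set⇒bag
        (Unique.map⁺ act-injective (Unique.filter⁺ (selects (X ∘ act f)) allPaths-unique))
        (Unique.filter⁺ (selects X) allPaths-unique)
        (mk⇔ to from)

  tiling-aut : ∀ {μs} f X → IsTiling μs X → IsTiling μs (X ∘ act f)
  tiling-aut f X (covers , sizes↭) = covers-aut f X covers , ↭-trans (sizes-aut f X) sizes↭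

module Representatives (n : ℕ) (S T : Cycle.PathSet n) where
  open Cycle n
  open Rotations n

  representative : Vertex → Pair
  representative i = S , T ∘ act (rot (toℕ i))

  representative-admissible : AutTrivial S → ∀ i → Admissible (representative i)
  representative-admissible rigidS i f fixS _ = rigidS f fixS

  -- An isomorphism of representatives fixes S, hence is the identity, so T is
  -- invariant under the rotation relating the two indices.
  representative-distinct : AutTrivial S → AutTrivial T →
    ∀ i j → IsoPair (representative i) (representative j) → i ≡ j
  representative-distinct rigidS rigidT i j (f , fixS , carriesT) =
    rigid-rotations-distinct rigidT i j sameRotation
    where
      sameRotation : ∀ p → T (act (rot (toℕ j)) p) ≡ T (act (rot (toℕ i)) p)
      sameRotation (s , l) =
        trans (cong (λ t → T (act (rot (toℕ j)) (t , l))) (sym (rigidS f fixS s))) (carriesT (s , l))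

  -- With f : S ≅ S' and g : T ≅ T', f⁻¹ carries (S' , T') onto the
  -- representative indexed by the rotation g⁻¹ ∘ f.
  representative-complete : ∀ {λs μs} →
    (∀ S' → IsTiling λs S' → IsoTiling S S') → (∀ T' → IsTiling μs T' → IsoTiling T T') →
    ∀ P → IsPairTiling λs μs P → ∃ λ i → IsoPair P (representative i)
  representative-complete uniqueS uniqueT (S' , T') (tilingS' , tilingT') =
    i , invA f , carries-inverse f carriesS , carriesT
    where
      f : Aut
      f = proj₁ (uniqueS S' tilingS')
      carriesS : Carries f S S'
      carriesS = proj₂ (uniqueS S' tilingS')
      g : Aut
      g = proj₁ (uniqueT T' tilingT')
      carriesT′ : Carries g T T'
      carriesT′ = proj₂ (uniqueT T' tilingT')
      φ : Vertex → Vertex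
      φ v = perm g ⟨$⟩ˡ (perm f ⟨$⟩ʳ v)
      i : Vertex
      i = φ Fin.zero
      φ-is-rotation : ∀ v → φ v ≡ rotate (toℕ i) v
      φ-is-rotation = edgeHom-is-rotation φ
        (λ a b e → Equivalence.to (preserves (invA g) _ _) (Equivalence.to (preserves f a b) e))
      carriesT : Carries (invA f) T' (T ∘ act (rot (toℕ i)))
      carriesT (s , l) = begin
        T (rotate (toℕ i) (perm f ⟨$⟩ˡ s) , l)             ≡⟨ cong (λ t → T (t , l)) (φ-is-rotation _) ⟨
        T (perm g ⟨$⟩ˡ (perm f ⟨$⟩ʳ (perm f ⟨$⟩ˡ s)) , l)  ≡⟨ cong (λ t → T (perm g ⟨$⟩ˡ t , l)) (inverseʳ (perm f)) ⟩
        T (perm g ⟨$⟩ˡ s , l)                             ≡⟨ carries-inverse g carriesT′ (s , l) ⟩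
        T' (s , l)                                        ∎
        where open ≡-Reasoning

proposition2p2 : (n : ℕ) (λs μs : List ℕ) →
    IsPartition (suc n) λs → IsPartition (suc n) μs →
    Cycle.UniqueRigidTiling n λs → Cycle.UniqueRigidTiling n μs →
    Cycle.η≡ n λs μs (suc n)
proposition2p2 n λs μs _ _ (S , tilingS , rigidS , uniqueS) (T , tilingT , rigidT , uniqueT) =
  tabulate representative , valid , distinct , complete
  where
    open Cycle n
    open Rotations n
    open TilingInvariance n
    open Representatives n S T
    entry : ∀ i → lookup (tabulate representative) i ≡ representative i
    entry = lookup∘tabulate representative
    valid : ∀ i → IsPairTiling λs μs (lookup (tabulate representative) i) × Admissible (lookup (tabulate representative) i)
    valid i = subst (λ P → IsPairTiling λs μs P × Admissible P) (sym (entry i))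
      ((tilingS , tiling-aut (rot (toℕ i)) T tilingT) , representative-admissible rigidS i)
    distinct : ∀ i j → IsoPair (lookup (tabulate representative) i) (lookup (tabulate representative) j) → i ≡ j
    distinct i j iso = representative-distinct rigidS rigidT i j (subst₂ IsoPair (entry i) (entry j) iso)
    complete : ∀ P → IsPairTiling λs μs P → Admissible P → ∃ λ i → IsoPair P (lookup (tabulate representative) i)
    complete P tilingP _ with representative-complete uniqueS uniqueT P tilingP
    ... | i , iso = i , subst (IsoPair P) (sym (entry i)) iso
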